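{- Let $\mathbb{I}$ be a consistent interval which is a bounded distributive lattice satisfying the Phoa principle and equipped with an internal sum structure that factors binary meets. Then $\mathbb{I}$ is based Segal complete: for every $j:\mathbb{I}$, every function $\alpha\colon[\![j]\!]_\bot\to\mathbb{I}$ extends uniquely along the inclusion $[\![j]\!]_\bot\hookrightarrow\mathbb{I}/j$, i.e. the restriction map $\mathbb{I}^{\mathbb{I}/j}\to\mathbb{I}^{[\![j]\!]_\bot}$ is an equivalence.
   Context: Homotopy type theory. An interval is a set $\mathbb{I}$ with bounded meet-semilattice structure $(0,1,\sqcap)$, $i\sqsubseteq j$ meaning $i\sqcap j=i$; $[\![i]\!]:\equiv(i=1)$. Consistent: $0\neq1$. Bounded distributive lattice: $\mathbb{I}$ also has binary joins $\sqcup$ making it a bounded distributive lattice. Phoa principle: every $\alpha\colon\mathbb{I}\to\mathbb{I}$ is monotone, and $\alpha,\beta\colon\mathbb{I}\to\mathbb{I}$ agreeing at $0$ and $1$ are equal. $L(X):\equiv\sum_{i:\mathbb{I}}X^{[\![i]\!]}$. An internal sum structure is a function $\Sigma\colon L(\mathbb{I})\to\mathbb{I}$ such that the square with top $\{(1,\lambda\_.1)\}\to\{1\}$, left $\{(1,\lambda\_.1)\}\hookrightarrow L(\mathbb{I})$, right $\{1\}\hookrightarrow\mathbb{I}$ and bottom $\Sigma$ is a pullback; it factors binary meets if $\Sigma(i,\lambda\_.j)=i\sqcap j$. $\mathbb{I}/j:\equiv\{i\mid i\sqsubseteq j\}$. The join $P*X$ is the pushout of $P\leftarrow P\times X\to X$;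 the Sierpiński cone of $X$ is $X_\bot:\equiv\sum_{i:\mathbb{I}}(i=0)*X$; $[\![j]\!]_\bot$ is the Sierpiński cone of the proposition $[\![j]\!]$, $\simeq\{i:\mathbb{I}\mid i=0\lor j=1\}$, included in $\mathbb{I}/j$ by $i\mapsto i$. A type is based Segal complete if for every $j$ it is local (restriction along the map is an equivalence) for $[\![j]\!]_\bot\hookrightarrow\mathbb{I}/j$. -}

{-# OPTIONS --without-K #-}
module Defs where

open import Level using (Level; _⊔_; suc)
open import Data.Product using (Σ; _,_; proj₁; proj₂; _×_)
open import Data.Sum using (_⊎_; inj₁; inj₂)
open import Data.Unit using (⊤; tt)
open import Relation.Nullary using (¬_)
open import Relation.Binary.PropositionalEquality
  using (_≡_; refl; sym; trans; cong)

isContr : ∀ {ℓ} → Set ℓ → Set ℓ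
isContr A = Σ A λ a → (b : A) → a ≡ b

isProp : ∀ {ℓ} → Set ℓ → Set ℓ
isProp A = (a b : A) → a ≡ b

isSet : ∀ {ℓ} → Set ℓ → Set ℓ
isSet A = (a b : A) → isProp (a ≡ b)

fiber : ∀ {ℓ ℓ'} {A : Set ℓ} {B : Set ℓ'} → (A → B) → B → Set (ℓ ⊔ ℓ')
fiber {A = A} f b = Σ A λ a → f a ≡ b

isEquiv : ∀ {ℓ ℓ'} {A : Set ℓ} {B : Set ℓ'} → (A → B) → Set (ℓ ⊔ ℓ')
isEquiv {B = B} f = (b : B) → isContr (fiber f b)

FunExt : (ℓ ℓ' : Level) → Set (suc (ℓ ⊔ ℓ'))
FunExt ℓ ℓ' = {A : Set ℓ} {B : A → Set ℓ'} {f g : (a : A) → B a}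
            → ((a : A) → f a ≡ g a) → f ≡ g

record PropTrunc (ℓ : Level) : Set (suc ℓ) where
  field
    ∥_∥      : Set ℓ → Set ℓ
    ∥∥-isProp : (A : Set ℓ) → isProp ∥ A ∥
    ∣_∣      : {A : Set ℓ} → A → ∥ A ∥
    ∥∥-rec   : {A B : Set ℓ} → isProp B → (A → B) → ∥ A ∥ → B

record DLInterval (ℓ : Level) : Set (suc ℓ) where
  field
    𝕀      : Set ℓ
    𝕀-set  : isSet 𝕀
    i0 i1  : 𝕀
    _⊓_    : 𝕀 → 𝕀 → 𝕀
    _⊔ᵢ_   : 𝕀 → 𝕀 → 𝕀
    ⊓-assoc : ∀ a b c → (a ⊓ b) ⊓ c ≡ a ⊓ (b ⊓ c)
    ⊓-comm  : ∀ a b → a ⊓ b ≡ b ⊓ a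
    ⊓-idem  : ∀ a → a ⊓ a ≡ a
    ⊓-unit  : ∀ a → a ⊓ i1 ≡ a
    ⊔-assoc : ∀ a b c → (a ⊔ᵢ b) ⊔ᵢ c ≡ a ⊔ᵢ (b ⊔ᵢ c)
    ⊔-comm  : ∀ a b → a ⊔ᵢ b ≡ b ⊔ᵢ a
    ⊔-idem  : ∀ a → a ⊔ᵢ a ≡ a
    ⊔-unit  : ∀ a → a ⊔ᵢ i0 ≡ a
    absorb-⊓⊔ : ∀ a b → a ⊓ (a ⊔ᵢ b) ≡ a
    absorb-⊔⊓ : ∀ a b → a ⊔ᵢ (a ⊓ b) ≡ a
    distrib : ∀ a b c → a ⊓ (b ⊔ᵢ c) ≡ (a ⊓ b) ⊔ᵢ (a ⊓ c)

  _⊑_ : 𝕀 → 𝕀 → Set ℓ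
  i ⊑ j = (i ⊓ j) ≡ i

  ⟦_⟧ : 𝕀 → Set ℓ
  ⟦ i ⟧ = i ≡ i1

  Consistent : Set ℓ
  Consistent = ¬ (i0 ≡ i1)

  Phoa : Set ℓ
  Phoa = ((α : 𝕀 → 𝕀) → ∀ i j → i ⊑ j → α i ⊑ α j)
       × ((α β : 𝕀 → 𝕀) → α i0 ≡ β i0 → α i1 ≡ β i1 → α ≡ β)

  L : ∀ {ℓ'} → Set ℓ' → Set (ℓ ⊔ ℓ')
  L X = Σ 𝕀 λ i → (⟦ i ⟧ → X)

  top : L 𝕀
  top = i1 , (λ _ → i1)

  -- Internal sum structure: Σ : L(𝕀) → 𝕀 together with a commuting square
  --   {(1,λ_.1)} → {1}
  --      ↓          ↓
  --    L(𝕀)  --Σ--> 𝕀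
  -- which is a pullback (the gap map into the canonical pullback is an
  -- equivalence).
  gapMap : (S : L 𝕀 → 𝕀) → S top ≡ i1
         → (Σ (L 𝕀) λ x → x ≡ top)
         → Σ (L 𝕀) λ x → Σ (Σ 𝕀 λ k → k ≡ i1) λ y → S x ≡ proj₁ y
  gapMap S h (x , p) = x , (i1 , refl) , trans (cong S p) h

  record InternalSum : Set ℓ where
    field
      Sum      : L 𝕀 → 𝕀
      Sum-top  : Sum top ≡ i1
      pullback : isEquiv (gapMap Sum Sum-top)

  FactorsMeets : InternalSum → Set ℓ
  FactorsMeets S = ∀ i j → InternalSum.Sum S (i , λ _ → j) ≡ i ⊓ j

  𝕀/ : 𝕀 → Set ℓ
  𝕀/ j = Σ 𝕀 λ i → i ⊑ j

  ⊓-zero : ∀ a → i0 ⊓ a ≡ i0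
  ⊓-zero a = trans (cong (i0 ⊓_) (sym (trans (⊔-comm i0 a) (⊔-unit a))))
                   (absorb-⊓⊔ i0 a)

  module _ (T : PropTrunc ℓ) where
    open PropTrunc T

    -- [[ j ]]_⊥ ≃ { i : 𝕀 | i = 0 ∨ j = 1 }
    Cone : 𝕀 → Set ℓ
    Cone j = Σ 𝕀 λ i → ∥ (i ≡ i0) ⊎ ⟦ j ⟧ ∥

    incl : (j : 𝕀) → Cone j → 𝕀/ j
    incl j (i , p) = i , ∥∥-rec (𝕀-set (i ⊓ j) i) h p
      where
      h : (i ≡ i0) ⊎ ⟦ j ⟧ → (i ⊓ j) ≡ i
      h (inj₁ refl) = ⊓-zero j
      h (inj₂ refl) = ⊓-unit i

    BasedSegalComplete : ∀ {ℓ'} → Set ℓ' → Set (ℓ ⊔ ℓ')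
    BasedSegalComplete X =
      (j : 𝕀) → isEquiv (λ (f : 𝕀/ j → X) → λ c → f (incl j c))

{-# OPTIONS --safe --without-K #-}
-- By the Phoa principle every β : 𝕀 → 𝕀 is affine, β k = β 0 ⊔ (k ⊓ β 1).
-- As 𝕀/j is a retract of 𝕀 via k ↦ k ⊓ j, a map g : 𝕀/j → 𝕀 is therefore
-- i ↦ g 0 ⊔ (i ⊓ j ⊓ g j), and j ⊓ g j = Σ(j, λ_. g j) since Σ factors
-- meets. So g is determined by its restriction α to the cone, which
-- records g 0 and, under j = 1, g j; conversely i ↦ α 0 ⊔ (i ⊓ Σ(j, α j))
-- restricts to α, because at j = 1 the sum is just α 1.
module Submission where

open import Defs
open import Level using (Level)
open import Data.Product using (Σ; _,_; proj₁; proj₂)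
open import Data.Product.Properties using (Σ-≡,≡→≡)
open import Data.Sum using (_⊎_; inj₁; inj₂)
open import Relation.Binary.PropositionalEquality
  using (_≡_; refl; sym; trans; cong; cong₂; cong-app; module ≡-Reasoning)
open import Axiom.UniquenessOfIdentityProofs using (module Constant⇒UIP)

private
  variable
    a b : Level
    A : Set a

Σ≡Prop : {B : A → Set b} → ((x : A) → isProp (B x))
       → {u v : Σ A B} → proj₁ u ≡ proj₁ v → u ≡ v
Σ≡Prop B-prop {v = v} p = Σ-≡,≡→≡ (p , B-prop (proj₁ v) _ _)

Π-isSet : {A : Set a} {B : A → Set b} → FunExt a b
        → ((x : A) → isSet (B x)) → isSet ((x : A) → B x)
Π-isSet {A = A} {B = B} fe B-set f g =
  Constant⇒UIP.≡-irrelevant canonical canonical-constant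
  where
  canonical : {f g : (x : A) → B x} → f ≡ g → f ≡ g
  canonical p = fe (cong-app p)

  canonical-constant : {f g : (x : A) → B x} (p q : f ≡ g) → canonical p ≡ canonical q
  canonical-constant p q = cong fe (fe (λ x → B-set x _ _ (cong-app p x) (cong-app q x)))

isContr-fiber : {B : Set b} → isSet B → (r : A → B) {y : B}
              → (f : A) → r f ≡ y → ((g : A) → r g ≡ y → g ≡ f)
              → isContr (fiber r y)
isContr-fiber B-set r f rf≡y unique =
  (f , rf≡y) , λ (g , rg≡y) → Σ≡Prop (λ h → B-set (r h) _) (sym (unique g rg≡y))

module _ {ℓ : Level} (I : DLInterval ℓ) where
  open DLInterval I

  ⊓-identityˡ : ∀ i → i1 ⊓ i ≡ i
  ⊓-identityˡ i = trans (⊓-comm i1 i) (⊓-unit i)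

  i⊑j⇒i⊔j≡j : ∀ {i j} → i ⊑ j → i ⊔ᵢ j ≡ j
  i⊑j⇒i⊔j≡j {i} {j} i⊑j = begin
    i ⊔ᵢ j           ≡⟨ cong (_⊔ᵢ j) (sym i⊑j) ⟩
    (i ⊓ j) ⊔ᵢ j     ≡⟨ ⊔-comm (i ⊓ j) j ⟩
    j ⊔ᵢ (i ⊓ j)     ≡⟨ cong (j ⊔ᵢ_) (⊓-comm i j) ⟩
    j ⊔ᵢ (j ⊓ i)     ≡⟨ absorb-⊔⊓ j i ⟩
    j                ∎
    where open ≡-Reasoning

  i⊑j⇒i⊓[j⊓k]≡i⊓k : ∀ {i j} k → i ⊑ j → i ⊓ (j ⊓ k) ≡ i ⊓ k
  i⊑j⇒i⊓[j⊓k]≡i⊓k {i} {j} k i⊑j = trans (sym (⊓-assoc i j k)) (cong (_⊓ k) i⊑j)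

  𝕀/-≡ : ∀ {j} {x y : 𝕀/ j} → proj₁ x ≡ proj₁ y → x ≡ y
  𝕀/-≡ = Σ≡Prop (λ i → 𝕀-set (i ⊓ _) i)

  ⊥/ : ∀ j → 𝕀/ j
  ⊥/ j = i0 , ⊓-zero j

  ⊤/ : ∀ j → 𝕀/ j
  ⊤/ j = j , ⊓-idem j

  _⊓/_ : 𝕀 → ∀ j → 𝕀/ j
  k ⊓/ j = k ⊓ j , trans (⊓-assoc k j j) (cong (k ⊓_) (⊓-idem j))

  module _ (phoa : Phoa) where
    phoa-normal-form : (β : 𝕀 → 𝕀) → ∀ k → β k ≡ β i0 ⊔ᵢ (k ⊓ β i1)
    phoa-normal-form β = cong-app (proj₂ phoa β affine agree-i0 agree-i1)
      where
      affine : 𝕀 → 𝕀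
      affine k = β i0 ⊔ᵢ (k ⊓ β i1)

      agree-i0 : β i0 ≡ affine i0
      agree-i0 = sym (trans (cong (β i0 ⊔ᵢ_) (⊓-zero (β i1))) (⊔-unit (β i0)))

      agree-i1 : β i1 ≡ affine i1
      agree-i1 = sym (trans (cong (β i0 ⊔ᵢ_) (⊓-identityˡ (β i1)))
                            (i⊑j⇒i⊔j≡j (proj₁ phoa β i0 i1 (⊓-zero i1))))

    slice-normal-form : ∀ {j} (g : 𝕀/ j → 𝕀) (x : 𝕀/ j)
                      → g x ≡ g (⊥/ j) ⊔ᵢ (proj₁ x ⊓ g (⊤/ j))
    slice-normal-form {j} g (i , i⊑j) = begin
      g (i , i⊑j)                 ≡⟨ cong g (𝕀/-≡ (sym i⊑j)) ⟩
      β i                         ≡⟨ phoa-normal-form β i ⟩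
      β i0 ⊔ᵢ (i ⊓ β i1)          ≡⟨ cong₂ (λ u v → u ⊔ᵢ (i ⊓ v))
                                       (cong g (𝕀/-≡ (⊓-zero j)))
                                       (cong g (𝕀/-≡ (⊓-identityˡ j))) ⟩
      g (⊥/ j) ⊔ᵢ (i ⊓ g (⊤/ j))  ∎
      where
      open ≡-Reasoning
      β : 𝕀 → 𝕀
      β k = g (k ⊓/ j)

  module _ (fe : FunExt ℓ ℓ) (S : InternalSum) (fm : FactorsMeets S) where
    open InternalSum S

    Sum-i1 : (φ : ⟦ i1 ⟧ → 𝕀) → Sum (i1 , φ) ≡ φ refl
    Sum-i1 φ = begin
      Sum (i1 , φ)             ≡⟨ cong (λ ψ → Sum (i1 , ψ)) (fe (λ p → cong φ (𝕀-set _ _ p refl))) ⟩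
      Sum (i1 , λ _ → φ refl)  ≡⟨ fm i1 (φ refl) ⟩
      i1 ⊓ φ refl              ≡⟨ ⊓-identityˡ (φ refl) ⟩
      φ refl                   ∎
      where open ≡-Reasoning

  module Extension (fe : FunExt ℓ ℓ) (T : PropTrunc ℓ) (phoa : Phoa)
    (S : InternalSum) (fm : FactorsMeets S) (j : 𝕀) (α : Cone T j → 𝕀) where
    open PropTrunc T
    open InternalSum S

    restrict : (𝕀/ j → 𝕀) → Cone T j → 𝕀
    restrict g c = g (incl T j c)

    α-irrelevant : ∀ {i} (t t' : ∥ (i ≡ i0) ⊎ ⟦ j ⟧ ∥) → α (i , t) ≡ α (i , t')
    α-irrelevant t t' = cong (λ t″ → α (_ , t″)) (∥∥-isProp _ t t')

    base : 𝕀
    base = α (i0 , ∣ inj₁ refl ∣)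

    apex : 𝕀
    apex = Sum (j , λ p → α (j , ∣ inj₂ p ∣))

    extension : 𝕀/ j → 𝕀
    extension (i , _) = base ⊔ᵢ (i ⊓ apex)

    extension-restricts-at-i0 : ∀ t → base ⊔ᵢ (i0 ⊓ apex) ≡ α (i0 , t)
    extension-restricts-at-i0 t =
      trans (cong (base ⊔ᵢ_) (⊓-zero apex)) (trans (⊔-unit base) (α-irrelevant _ t))

    extension-restricts-at-j≡i1 : ⟦ j ⟧ → ∀ i t → base ⊔ᵢ (i ⊓ apex) ≡ α (i , t)
    extension-restricts-at-j≡i1 refl i t = begin
      base ⊔ᵢ (i ⊓ apex)   ≡⟨ cong (λ v → base ⊔ᵢ (i ⊓ v)) (Sum-i1 fe S fm _) ⟩
      base ⊔ᵢ (i ⊓ β i1)   ≡⟨ cong (_⊔ᵢ (i ⊓ β i1)) (α-irrelevant _ _) ⟩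
      β i0 ⊔ᵢ (i ⊓ β i1)   ≡⟨ sym (phoa-normal-form phoa β i) ⟩
      β i                  ≡⟨ α-irrelevant _ t ⟩
      α (i , t)            ∎
      where
      open ≡-Reasoning
      β : 𝕀 → 𝕀
      β k = α (k , ∣ inj₂ refl ∣)

    extension-restricts : restrict extension ≡ α
    extension-restricts = fe λ (i , t) → ∥∥-rec (𝕀-set _ _) (restricts-at i t) t
      where
      restricts-at : ∀ i t → (i ≡ i0) ⊎ ⟦ j ⟧ → extension (incl T j (i , t)) ≡ α (i , t)
      restricts-at _ t (inj₁ refl) = extension-restricts-at-i0 t
      restricts-at i t (inj₂ j≡i1) = extension-restricts-at-j≡i1 j≡i1 i t

    extension-unique : (g : 𝕀/ j → 𝕀) → restrict g ≡ α → g ≡ extension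
    extension-unique g g↾≡α = fe λ (i , i⊑j) → begin
      g (i , i⊑j)                       ≡⟨ slice-normal-form phoa g (i , i⊑j) ⟩
      g (⊥/ j) ⊔ᵢ (i ⊓ g (⊤/ j))        ≡⟨ cong (g (⊥/ j) ⊔ᵢ_) (sym (i⊑j⇒i⊓[j⊓k]≡i⊓k _ i⊑j)) ⟩
      g (⊥/ j) ⊔ᵢ (i ⊓ (j ⊓ g (⊤/ j)))  ≡⟨ cong₂ (λ u v → u ⊔ᵢ (i ⊓ v)) g⊥≡base j⊓g⊤≡apex ⟩
      base ⊔ᵢ (i ⊓ apex)                ∎
      where
      open ≡-Reasoning
      g-agrees : (c : Cone T j) → g (incl T j c) ≡ α c
      g-agrees = cong-app g↾≡α

      g⊥≡base : g (⊥/ j) ≡ base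
      g⊥≡base = trans (cong g (𝕀/-≡ refl)) (g-agrees (i0 , ∣ inj₁ refl ∣))

      j⊓g⊤≡apex : j ⊓ g (⊤/ j) ≡ apex
      j⊓g⊤≡apex = trans (sym (fm j (g (⊤/ j))))
        (cong (λ φ → Sum (j , φ))
              (fe λ p → trans (cong g (𝕀/-≡ refl)) (g-agrees (j , ∣ inj₂ p ∣))))

    restrict-isContr-fiber : isContr (fiber restrict α)
    restrict-isContr-fiber =
      isContr-fiber (Π-isSet fe (λ _ → 𝕀-set)) restrict extension
                    extension-restricts extension-unique

theoremV6 : {ℓ : Level} → FunExt ℓ ℓ → (T : PropTrunc ℓ) → (I : DLInterval ℓ)
    → DLInterval.Consistent I
    → DLInterval.Phoa I
    → (S : DLInterval.InternalSum I) → DLInterval.FactorsMeets I S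
    → DLInterval.BasedSegalComplete I T (DLInterval.𝕀 I)
theoremV6 fe T I _ phoa S fm j α =
  Extension.restrict-isContr-fiber I fe T phoa S fm j α
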